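{- Let $K$ be a field of characteristic not $2$. Then: (1) For every integer $n\ge0$, $S_K^{\mathrm{adv}_n}=S_K^{\mathrm{adv}_\infty}$ if and only if $S_K^{\mathrm{back}_n}=S_K^{\mathrm{back}_\infty}$. (2) For every integer $n\ge0$, $S_K^{\mathrm{adv}_n}\cap S_K^{\mathrm{back}_\infty}=S_K^{\mathrm{cyc}}$ if and only if $S_K^{\mathrm{back}_n}\cap S_K^{\mathrm{adv}_\infty}=S_K^{\mathrm{cyc}}$. (3) For every $n\in\{0,1,2,\dots\}\cup\{\infty\}$, $\left|S_K^{\mathrm{adv}_n}\right|=\left|S_K^{\mathrm{back}_n}\right|$ (as cardinalities; in particular one is finite if and only if the other is).
   Context: $S_K=\{(\alpha,\beta)\in K^2:\alpha,\beta,\alpha+\beta,\alpha-\beta\neq 0\}$. For $(\alpha,\beta),(\gamma,\delta)\in S_K$ write $(\alpha,\beta)\mapsto(\gamma,\delta)$ if $2\gamma=\alpha+\beta$ and $\delta^2=\alpha\beta$. For $n\ge0$, $S_K^{\mathrm{adv}_n}$ (resp. $S_K^{\mathrm{back}_n}$) is the set of $x_0\in S_K$ admitting $x_1,\dots,x_n\in S_K$ with $x_0\mapsto x_1\mapsto\cdots\mapsto x_n$ (resp. $x_{ -1},\dots,x_{ -n}\in S_K$ with $x_{ -n}\mapsto\cdots\mapsto x_{ -1}\mapsto x_0$); $S_K^{\mathrm{adv}_\infty}=\bigcap_n S_K^{\mathrm{adv}_n}$, $S_K^{\mathrm{back}_\infty}=\bigcap_n S_K^{\mathrm{back}_n}$,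 and $S_K^{\mathrm{cyc}}=S_K^{\mathrm{adv}_\infty}\cap S_K^{\mathrm{back}_\infty}$. -}

module Defs where

open import Level using (Level; _⊔_; suc)
open import Algebra.Bundles using (CommutativeRing)
open import Data.Nat using (ℕ; zero)
import Data.Nat as N
open import Data.Product using (Σ; ∃; _×_; _,_; proj₁; proj₂)
open import Data.Unit.Polymorphic using (⊤)
open import Relation.Nullary using (¬_)
open import Relation.Binary.Bundles using (Setoid)
open import Function.Bundles using (Bijection; _⇔_)

record Field (c ℓ : Level) : Set (suc (c ⊔ ℓ)) where
  field
    commutativeRing : CommutativeRing c ℓ
  open CommutativeRing commutativeRing public
  field
    1≉0     : ¬ (1# ≈ 0#)
    inverse : ∀ x → ¬ (x ≈ 0#) → ∃ λ y → x * y ≈ 1#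

CharNot2 : ∀ {c ℓ} → Field c ℓ → Set ℓ
CharNot2 K = ¬ ((1# + 1#) ≈ 0#)
  where open Field K

module Dynamics {c ℓ} (K : Field c ℓ) where
  open Field K

  Pair : Set c
  Pair = Carrier × Carrier

  InS : Pair → Set ℓ
  InS (α , β) = ¬ (α ≈ 0#) × ¬ (β ≈ 0#) × ¬ ((α + β) ≈ 0#) × ¬ ((α - β) ≈ 0#)

  _↦_ : Pair → Pair → Set ℓ
  (α , β) ↦ (γ , δ) = ((1# + 1#) * γ ≈ α + β) × (δ * δ ≈ α * β)

  AdvChain : ℕ → Pair → Set (c ⊔ ℓ)
  AdvChain zero    x = ⊤
  AdvChain (N.suc n) x = Σ Pair λ y → InS y × (x ↦ y) × AdvChain n y

  BackChain : ℕ → Pair → Set (c ⊔ ℓ)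
  BackChain zero    x = ⊤
  BackChain (N.suc n) x = Σ Pair λ y → InS y × (y ↦ x) × BackChain n y

  Adv : ℕ → Pair → Set (c ⊔ ℓ)
  Adv n x = InS x × AdvChain n x

  Back : ℕ → Pair → Set (c ⊔ ℓ)
  Back n x = InS x × BackChain n x

  Adv∞ : Pair → Set (c ⊔ ℓ)
  Adv∞ x = InS x × (∀ n → AdvChain n x)

  Back∞ : Pair → Set (c ⊔ ℓ)
  Back∞ x = InS x × (∀ n → BackChain n x)

  Cyc : Pair → Set (c ⊔ ℓ)
  Cyc x = Adv∞ x × Back∞ x

  _≐_ : (Pair → Set (c ⊔ ℓ)) → (Pair → Set (c ⊔ ℓ)) → Set (c ⊔ ℓ)
  P ≐ Q = ∀ x → P x ⇔ Q x

  _∩_ : (Pair → Set (c ⊔ ℓ)) → (Pair → Set (c ⊔ ℓ)) → Pair → Set (c ⊔ ℓ)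
  (P ∩ Q) x = P x × Q x

  SubSetoid : (Pair → Set (c ⊔ ℓ)) → Setoid (c ⊔ ℓ) ℓ
  SubSetoid P = record
    { Carrier = Σ Pair P
    ; _≈_ = λ x y → (proj₁ (proj₁ x) ≈ proj₁ (proj₁ y)) × (proj₂ (proj₁ x) ≈ proj₂ (proj₁ y))
    ; isEquivalence = record
      { refl = refl , refl
      ; sym = λ (p , q) → sym p , sym q
      ; trans = λ (p , q) (p' , q') → trans p p' , trans q q' } }

  SameCard : (Pair → Set (c ⊔ ℓ)) → (Pair → Set (c ⊔ ℓ)) → Set (c ⊔ ℓ)
  SameCard P Q = Bijection (SubSetoid P) (SubSetoid Q)

{-# OPTIONS --safe #-}
module Submission where

-- For t ≉ 0 the map rotate t (a , b) = (t(a + b) , t(a - b)) preserves S_K and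
-- reverses arrows up to rescaling: x ↦ y implies rotate 2t y ↦ rotate t x.
-- Hence it turns forward chains of length n from x into backward chains of
-- length n into rotate t x, and conversely. Since rotate s ∘ rotate t is
-- multiplication by 2st, rotate 1 and rotate ½ are mutually inverse, so they
-- give bijections S^adv_n ≅ S^back_n (n ≤ ∞) exchanging S^adv_∞ and S^back_∞,
-- and these transport each set equality in (1) and (2) to the other side.

open import Defs
open import Level using (_⊔_)
open import Data.Nat using (ℕ; zero; suc)
open import Data.Product using (_×_; _,_; proj₁; proj₂; swap)
open import Data.Product.Relation.Binary.Pointwise.NonDependent using (×-setoid)
open import Data.Unit.Polymorphic using (tt)
open import Function.Bundles using (_⇔_; mk⇔; Equivalence)
open import Function.Properties.Inverse using (Inverse⇒Bijection)
open import Relation.Unary using (Pred; _⊆_)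
open import Relation.Binary.Bundles using (Setoid)
open import Relation.Binary.Definitions using (_Respects_)
import Algebra.Properties.Group as GroupProperties
import Algebra.Properties.Ring as RingProperties
import Algebra.Solver.Ring.NaturalCoefficients.Default as SemiringSolver
import Relation.Binary.Properties.Setoid as SetoidProperties
import Relation.Binary.Reasoning.Setoid as SetoidReasoning

module Rotation {c ℓ} (K : Field c ℓ) where
  open Field K
  open Dynamics K
  open GroupProperties +-group using (//-rightDividesˡ; x≈z//y; ∙-cancelʳ)
  open RingProperties ring using (x[y-z]≈xy-xz)
  open SemiringSolver commutativeSemiring using (solve; _:=_; _:+_; _:*_; con)
  open SetoidReasoning setoid

  x*y≉0 : ∀ {x y} → x ≉ 0# → y ≉ 0# → x * y ≉ 0#
  x*y≉0 {x} {y} x≉0 y≉0 xy≈0 = y≉0 (begin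
    y              ≈⟨ sym (*-identityˡ y) ⟩
    1# * y         ≈⟨ *-congʳ (sym xx⁻¹≈1) ⟩
    x * x⁻¹ * y    ≈⟨ solve 3 (λ x x⁻¹ y → x :* x⁻¹ :* y := x⁻¹ :* (x :* y)) refl x x⁻¹ y ⟩
    x⁻¹ * (x * y)  ≈⟨ *-congˡ xy≈0 ⟩
    x⁻¹ * 0#       ≈⟨ zeroʳ x⁻¹ ⟩
    0#             ∎)
    where
    x⁻¹ : Carrier
    x⁻¹ = proj₁ (inverse x x≉0)
    xx⁻¹≈1 : x * x⁻¹ ≈ 1#
    xx⁻¹≈1 = proj₂ (inverse x x≉0)

  two : Carrier
  two = 1# + 1#

  -- The solver only knows semirings: writing x as (x - y) + y, with x - y a
  -- fresh variable, turns each of the next four identities into a semiring one.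
  x-y+y≈x : ∀ x y → x - y + y ≈ x
  x-y+y≈x x y = //-rightDividesˡ y x

  [x+y]+[x-y]≈2x : ∀ x y → (x + y) + (x - y) ≈ two * x
  [x+y]+[x-y]≈2x x y = begin
    (x + y) + (x - y)          ≈⟨ +-congʳ (+-congʳ (sym (x-y+y≈x x y))) ⟩
    (x - y + y + y) + (x - y)  ≈⟨ solve 2 (λ q y → (q :+ y :+ y) :+ q := con 2 :* (q :+ y)) refl (x - y) y ⟩
    two * (x - y + y)          ≈⟨ *-congˡ (x-y+y≈x x y) ⟩
    two * x                    ∎

  [x+y]-[x-y]≈2y : ∀ x y → (x + y) - (x - y) ≈ two * y
  [x+y]-[x-y]≈2y x y = sym (x≈z//y (two * y) (x - y) (x + y) (begin
    two * y + (x - y)  ≈⟨ solve 2 (λ q y → con 2 :* y :+ q := q :+ y :+ y) refl (x - y) y ⟩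
    x - y + y + y      ≈⟨ +-congʳ (x-y+y≈x x y) ⟩
    x + y              ∎))

  [x+y][x-y]+yy≈xx : ∀ x y → (x + y) * (x - y) + y * y ≈ x * x
  [x+y][x-y]+yy≈xx x y = begin
    (x + y) * (x - y) + y * y          ≈⟨ +-congʳ (*-congʳ (+-congʳ (sym (x-y+y≈x x y)))) ⟩
    (x - y + y + y) * (x - y) + y * y  ≈⟨ solve 2 (λ q y → (q :+ y :+ y) :* q :+ y :* y := (q :+ y) :* (q :+ y)) refl (x - y) y ⟩
    (x - y + y) * (x - y + y)          ≈⟨ *-cong (x-y+y≈x x y) (x-y+y≈x x y) ⟩
    x * x                              ∎

  [x-y][x-y]+2[2xy]≈[x+y][x+y] : ∀ x y → (x - y) * (x - y) + two * (two * (x * y)) ≈ (x + y) * (x + y)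
  [x-y][x-y]+2[2xy]≈[x+y][x+y] x y = begin
    (x - y) * (x - y) + two * (two * (x * y))
      ≈⟨ +-congˡ (*-congˡ (*-congˡ (*-congʳ (sym (x-y+y≈x x y))))) ⟩
    (x - y) * (x - y) + two * (two * ((x - y + y) * y))
      ≈⟨ solve 2 (λ q y → q :* q :+ con 2 :* (con 2 :* ((q :+ y) :* y)) := (q :+ y :+ y) :* (q :+ y :+ y)) refl (x - y) y ⟩
    (x - y + y + y) * (x - y + y + y)
      ≈⟨ *-cong (+-congʳ (x-y+y≈x x y)) (+-congʳ (x-y+y≈x x y)) ⟩
    (x + y) * (x + y) ∎

  open Setoid (×-setoid setoid setoid) public
    using () renaming (_≈_ to _≈ₚ_; trans to ≈ₚ-trans)

  rotate : Carrier → Pair → Pair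
  rotate t (a , b) = t * (a + b) , t * (a - b)

  rotate-cong : ∀ {s t x y} → s ≈ t → x ≈ₚ y → rotate s x ≈ₚ rotate t y
  rotate-cong s≈t (a≈a′ , b≈b′) = *-cong s≈t (+-cong a≈a′ b≈b′) , *-cong s≈t (+-cong a≈a′ (-‿cong b≈b′))

  rotate-sum : ∀ t a b → t * (a + b) + t * (a - b) ≈ t * (two * a)
  rotate-sum t a b = trans (sym (distribˡ t (a + b) (a - b))) (*-congˡ ([x+y]+[x-y]≈2x a b))

  rotate-difference : ∀ t a b → t * (a + b) - t * (a - b) ≈ t * (two * b)
  rotate-difference t a b = trans (sym (x[y-z]≈xy-xz t (a + b) (a - b))) (*-congˡ ([x+y]-[x-y]≈2y a b))

  rotate-inverse : ∀ {s t} → s * (t * two) ≈ 1# → ∀ x → rotate s (rotate t x) ≈ₚ x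
  rotate-inverse {s} {t} st2≈1 (a , b) =
    trans (*-congˡ (rotate-sum t a b)) (cancel a) ,
    trans (*-congˡ (rotate-difference t a b)) (cancel b)
    where
    cancel : ∀ a → s * (t * (two * a)) ≈ a
    cancel a = begin
      s * (t * (two * a))  ≈⟨ solve 3 (λ s t a → s :* (t :* (con 2 :* a)) := s :* (t :* con 2) :* a) refl s t a ⟩
      s * (t * two) * a    ≈⟨ *-congʳ st2≈1 ⟩
      1# * a               ≈⟨ *-identityˡ a ⟩
      a                    ∎

  -- Both sides of the product condition equal (2t)²(g² - d²); to stay within
  -- semiring identities they are compared after adding (2t)² d².
  rotate-reverses-↦ : ∀ {t x y} → x ↦ y → rotate (two * t) y ↦ rotate t x
  rotate-reverses-↦ {t} {a , b} {g , d} (2g≈a+b , d²≈ab) = sum-condition , product-condition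
    where
    sum-condition : two * (t * (a + b)) ≈ two * t * (g + d) + two * t * (g - d)
    sum-condition = sym (begin
      two * t * (g + d) + two * t * (g - d)  ≈⟨ rotate-sum (two * t) g d ⟩
      two * t * (two * g)                    ≈⟨ *-congˡ 2g≈a+b ⟩
      two * t * (a + b)                      ≈⟨ *-assoc two t (a + b) ⟩
      two * (t * (a + b))                    ∎)
    product-condition : t * (a - b) * (t * (a - b)) ≈ two * t * (g + d) * (two * t * (g - d))
    product-condition = ∙-cancelʳ (two * t * (two * t) * (d * d)) _ _ (begin
      t * (a - b) * (t * (a - b)) + two * t * (two * t) * (d * d)
        ≈⟨ +-congˡ (*-congˡ d²≈ab) ⟩
      t * (a - b) * (t * (a - b)) + two * t * (two * t) * (a * b)
        ≈⟨ solve 4 (λ t q a b → t :* q :* (t :* q) :+ con 2 :* t :* (con 2 :* t) :* (a :* b)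
                               := t :* t :* (q :* q :+ con 2 :* (con 2 :* (a :* b)))) refl t (a - b) a b ⟩
      t * t * ((a - b) * (a - b) + two * (two * (a * b)))
        ≈⟨ *-congˡ ([x-y][x-y]+2[2xy]≈[x+y][x+y] a b) ⟩
      t * t * ((a + b) * (a + b))
        ≈⟨ *-congˡ (*-cong (sym 2g≈a+b) (sym 2g≈a+b)) ⟩
      t * t * (two * g * (two * g))
        ≈⟨ solve 2 (λ t g → t :* t :* (con 2 :* g :* (con 2 :* g)) := con 2 :* t :* (con 2 :* t) :* (g :* g)) refl t g ⟩
      two * t * (two * t) * (g * g)
        ≈⟨ *-congˡ ([x+y][x-y]+yy≈xx g d) ⟨
      two * t * (two * t) * ((g + d) * (g - d) + d * d)
        ≈⟨ solve 4 (λ t g d e → con 2 :* t :* (con 2 :* t) :* ((g :+ d) :* e :+ d :* d)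
                               := con 2 :* t :* (g :+ d) :* (con 2 :* t :* e) :+ con 2 :* t :* (con 2 :* t) :* (d :* d)) refl t g d (g - d) ⟩
      two * t * (g + d) * (two * t * (g - d)) + two * t * (two * t) * (d * d) ∎)

module Subsets {c ℓ} (K : Field c ℓ) where
  open Field K
  open Dynamics K
  open Rotation K using (_≈ₚ_)
  open SetoidProperties setoid using (≉-respˡ)

  ↦-resp : ∀ {x x′ y y′} → x ≈ₚ x′ → y ≈ₚ y′ → x ↦ y → x′ ↦ y′
  ↦-resp (a≈a′ , b≈b′) (g≈g′ , d≈d′) (2g≈a+b , d²≈ab) =
    trans (*-congˡ (sym g≈g′)) (trans 2g≈a+b (+-cong a≈a′ b≈b′)) ,
    trans (*-cong (sym d≈d′) (sym d≈d′)) (trans d²≈ab (*-cong a≈a′ b≈b′))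

  InS-resp : InS Respects _≈ₚ_
  InS-resp (a≈a′ , b≈b′) (a≉0 , b≉0 , a+b≉0 , a-b≉0) =
    ≉-respˡ a≈a′ a≉0 , ≉-respˡ b≈b′ b≉0 ,
    ≉-respˡ (+-cong a≈a′ b≈b′) a+b≉0 , ≉-respˡ (+-cong a≈a′ (-‿cong b≈b′)) a-b≉0

  AdvChain-resp : ∀ n → AdvChain n Respects _≈ₚ_
  AdvChain-resp zero    _   _ = tt
  AdvChain-resp (suc n) x≈x′ (y , y∈S , x↦y , chain) = y , y∈S , ↦-resp x≈x′ (refl , refl) x↦y , chain

  BackChain-resp : ∀ n → BackChain n Respects _≈ₚ_
  BackChain-resp zero    _   _ = tt
  BackChain-resp (suc n) x≈x′ (y , y∈S , y↦x , chain) = y , y∈S , ↦-resp (refl , refl) x≈x′ y↦x , chain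

  Adv∞-resp : Adv∞ Respects _≈ₚ_
  Adv∞-resp x≈x′ (x∈S , chains) = InS-resp x≈x′ x∈S , λ n → AdvChain-resp n x≈x′ (chains n)

  Back∞-resp : Back∞ Respects _≈ₚ_
  Back∞-resp x≈x′ (x∈S , chains) = InS-resp x≈x′ x∈S , λ n → BackChain-resp n x≈x′ (chains n)

  Cyc-resp : Cyc Respects _≈ₚ_
  Cyc-resp x≈x′ (adv , back) = Adv∞-resp x≈x′ adv , Back∞-resp x≈x′ back

  Adv∞⊆Adv : ∀ n → Adv∞ ⊆ Adv n
  Adv∞⊆Adv n (x∈S , chains) = x∈S , chains n

  Back∞⊆Back : ∀ n → Back∞ ⊆ Back n
  Back∞⊆Back n (x∈S , chains) = x∈S , chains n

  Cyc⊆Adv∩Back∞ : ∀ n → Cyc ⊆ (Adv n ∩ Back∞)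
  Cyc⊆Adv∩Back∞ n (adv , back) = Adv∞⊆Adv n adv , back

  Cyc⊆Back∩Adv∞ : ∀ n → Cyc ⊆ (Back n ∩ Adv∞)
  Cyc⊆Back∩Adv∞ n (adv , back) = Back∞⊆Back n back , adv

module Duality {c ℓ} (K : Field c ℓ) (char≢2 : CharNot2 K) where
  open Field K
  open Dynamics K
  open Rotation K
  open Subsets K using (↦-resp)
  open SetoidProperties setoid using (≉-respˡ)

  ½ : Carrier
  ½ = proj₁ (inverse two char≢2)

  2*½≈1 : two * ½ ≈ 1#
  2*½≈1 = proj₂ (inverse two char≢2)

  ½≉0 : ½ ≉ 0#
  ½≉0 ½≈0 = 1≉0 (trans (sym 2*½≈1) (trans (*-congˡ ½≈0) (zeroʳ two)))

  rotate-1∘rotate-½ : ∀ x → rotate 1# (rotate ½ x) ≈ₚ x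
  rotate-1∘rotate-½ = rotate-inverse (trans (*-identityˡ _) (trans (*-comm ½ two) 2*½≈1))

  rotate-½∘rotate-1 : ∀ x → rotate ½ (rotate 1# x) ≈ₚ x
  rotate-½∘rotate-1 = rotate-inverse (trans (*-congˡ (*-identityˡ two)) (trans (*-comm ½ two) 2*½≈1))

  rotate-InS : ∀ {t x} → t ≉ 0# → InS x → InS (rotate t x)
  rotate-InS {t} {a , b} t≉0 (a≉0 , b≉0 , a+b≉0 , a-b≉0) =
    x*y≉0 t≉0 a+b≉0 , x*y≉0 t≉0 a-b≉0 ,
    ≉-respˡ (sym (rotate-sum t a b)) (x*y≉0 t≉0 (x*y≉0 char≢2 a≉0)) ,
    ≉-respˡ (sym (rotate-difference t a b)) (x*y≉0 t≉0 (x*y≉0 char≢2 b≉0))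

  AdvChain⇒BackChain : ∀ n {t x} → t ≉ 0# → AdvChain n x → BackChain n (rotate t x)
  AdvChain⇒BackChain zero    _ _ = tt
  AdvChain⇒BackChain (suc n) {t} t≉0 (y , y∈S , x↦y , chain) =
    rotate (two * t) y , rotate-InS 2t≉0 y∈S , rotate-reverses-↦ x↦y , AdvChain⇒BackChain n 2t≉0 chain
    where
    2t≉0 : two * t ≉ 0#
    2t≉0 = x*y≉0 char≢2 t≉0

  BackChain⇒AdvChain : ∀ n {t x} → t ≉ 0# → BackChain n x → AdvChain n (rotate t x)
  BackChain⇒AdvChain zero    _ _ = tt
  BackChain⇒AdvChain (suc n) {t} t≉0 (y , y∈S , y↦x , chain) =
    rotate (½ * t) y , rotate-InS ½t≉0 y∈S ,
    ↦-resp (rotate-cong 2[½t]≈t (refl , refl)) (refl , refl) (rotate-reverses-↦ y↦x) ,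
    BackChain⇒AdvChain n ½t≉0 chain
    where
    ½t≉0 : ½ * t ≉ 0#
    ½t≉0 = x*y≉0 ½≉0 t≉0
    2[½t]≈t : two * (½ * t) ≈ t
    2[½t]≈t = trans (sym (*-assoc two ½ t)) (trans (*-congʳ 2*½≈1) (*-identityˡ t))

  RotatesInto : Pred Pair (c ⊔ ℓ) → Pred Pair (c ⊔ ℓ) → Set (c ⊔ ℓ)
  RotatesInto P Q = ∀ {t x} → t ≉ 0# → P x → Q (rotate t x)

  Dual : Pred Pair (c ⊔ ℓ) → Pred Pair (c ⊔ ℓ) → Set (c ⊔ ℓ)
  Dual P Q = RotatesInto P Q × RotatesInto Q P

  private
    variable
      P P′ Q Q′ : Pred Pair (c ⊔ ℓ)

  ∩-dual : Dual P Q → Dual P′ Q′ → Dual (P ∩ P′) (Q ∩ Q′)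
  ∩-dual (P⇒Q , Q⇒P) (P′⇒Q′ , Q′⇒P′) =
    (λ t≉0 (p , p′) → P⇒Q t≉0 p , P′⇒Q′ t≉0 p′) ,
    (λ t≉0 (q , q′) → Q⇒P t≉0 q , Q′⇒P′ t≉0 q′)

  ∩-self-dual : Dual P Q → Dual (P ∩ Q) (P ∩ Q)
  ∩-self-dual {P} {Q} (P⇒Q , Q⇒P) = both , both
    where
    both : RotatesInto (P ∩ Q) (P ∩ Q)
    both t≉0 (p , q) = Q⇒P t≉0 q , P⇒Q t≉0 p

  dual⇒SameCard : Dual P Q → SameCard P Q
  dual⇒SameCard (P⇒Q , Q⇒P) = Inverse⇒Bijection record
    { to        = λ (x , p) → rotate 1# x , P⇒Q 1≉0 p
    ; from      = λ (y , q) → rotate ½ y , Q⇒P ½≉0 q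
    ; to-cong   = rotate-cong refl
    ; from-cong = rotate-cong refl
    ; inverse   = (λ y≈½x → ≈ₚ-trans (rotate-cong refl y≈½x) (rotate-1∘rotate-½ _))
                , (λ y≈1x → ≈ₚ-trans (rotate-cong refl y≈1x) (rotate-½∘rotate-1 _))
    }

  ⊆-dual : Dual P P′ → Dual Q Q′ → Q′ Respects _≈ₚ_ → P ⊆ Q → P′ ⊆ Q′
  ⊆-dual (_ , P′⇒P) (Q⇒Q′ , _) resp P⊆Q p′ =
    resp (rotate-1∘rotate-½ _) (Q⇒Q′ 1≉0 (P⊆Q (P′⇒P ½≉0 p′)))

  ≐⇒⊆ : P ≐ Q → P ⊆ Q
  ≐⇒⊆ P≐Q {x} = Equivalence.to (P≐Q x)

  ⊆-antisym : P ⊆ Q → Q ⊆ P → P ≐ Q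
  ⊆-antisym P⊆Q Q⊆P _ = mk⇔ P⊆Q Q⊆P

  ≐-dual : Dual P P′ → Dual Q Q′ → Q Respects _≈ₚ_ → Q′ Respects _≈ₚ_ →
           Q ⊆ P → Q′ ⊆ P′ → (P ≐ Q) ⇔ (P′ ≐ Q′)
  ≐-dual P~P′ Q~Q′ resp resp′ Q⊆P Q′⊆P′ = mk⇔
    (λ P≐Q → ⊆-antisym (⊆-dual P~P′ Q~Q′ resp′ (≐⇒⊆ P≐Q)) Q′⊆P′)
    (λ P′≐Q′ → ⊆-antisym (⊆-dual (swap P~P′) (swap Q~Q′) resp (≐⇒⊆ P′≐Q′)) Q⊆P)

  Adv-Back-dual : ∀ n → Dual (Adv n) (Back n)
  Adv-Back-dual n =
    (λ t≉0 (x∈S , chain) → rotate-InS t≉0 x∈S , AdvChain⇒BackChain n t≉0 chain) ,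
    (λ t≉0 (x∈S , chain) → rotate-InS t≉0 x∈S , BackChain⇒AdvChain n t≉0 chain)

  Adv∞-Back∞-dual : Dual Adv∞ Back∞
  Adv∞-Back∞-dual =
    (λ t≉0 (x∈S , chains) → rotate-InS t≉0 x∈S , λ n → AdvChain⇒BackChain n t≉0 (chains n)) ,
    (λ t≉0 (x∈S , chains) → rotate-InS t≉0 x∈S , λ n → BackChain⇒AdvChain n t≉0 (chains n))

corollary5p4 : ∀ {c ℓ} (K : Field c ℓ) → CharNot2 K →
    let open Dynamics K in
    (∀ (n : ℕ) → (Adv n ≐ Adv∞) ⇔ (Back n ≐ Back∞))
    × (∀ (n : ℕ) → ((Adv n ∩ Back∞) ≐ Cyc) ⇔ ((Back n ∩ Adv∞) ≐ Cyc))
    × (∀ (n : ℕ) → SameCard (Adv n) (Back n))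
    × SameCard Adv∞ Back∞
corollary5p4 K char≢2 =
  (λ n → ≐-dual (Adv-Back-dual n) Adv∞-Back∞-dual Adv∞-resp Back∞-resp (Adv∞⊆Adv n) (Back∞⊆Back n)) ,
  (λ n → ≐-dual (∩-dual (Adv-Back-dual n) (swap Adv∞-Back∞-dual)) (∩-self-dual Adv∞-Back∞-dual)
                Cyc-resp Cyc-resp (Cyc⊆Adv∩Back∞ n) (Cyc⊆Back∩Adv∞ n)) ,
  (λ n → dual⇒SameCard (Adv-Back-dual n)) ,
  dual⇒SameCard Adv∞-Back∞-dual
  where
  open Subsets K
  open Duality K char≢2
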